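{- (a) Every numerical semigroup has an $m$-centric minimal presentation (where $m$ is its multiplicity). (b) Let $S$ be a numerical semigroup with multiplicity $m$ and let $\rho$ be an $m$-centric minimal presentation of $S$. Then each $(z,z')\in\rho$ satisfies $\varphi_S(z)-z_0m\in\mathrm{Ap}(S;m)$. In particular, $z_0>0$ if and only if $\varphi_S(z)\notin\mathrm{Ap}(S;m)$.
   Context: A numerical semigroup is a cofinite submonoid $S$ of $(\mathbb Z_{\ge0},+)$; its multiplicity $m$ is its smallest positive element. Write its minimal generators as $m<n_1<\dots<n_k$. $\mathrm{Ap}(S;m)=\{n\in S:n-m\notin S\}=\{0,a_1,\dots,a_{m-1}\}$ with $a_i\equiv i\pmod m$, $a_0=0$. Kunz poset $P$: $\mathbb Z_m$ with $i\preceq j$ iff $a_j-a_i\in\mathrm{Ap}(S;m)$; Kunz nilsemigroup $N=\mathbb Z_m\cup\{\infty\}$, $\infty$ absorbing, $i\oplus j=i+j$ if $a_i+a_j=a_{i+j}$ and $\infty$ otherwise. Its atoms are $p_i=n_i\bmod m$, $i=1,\dots,k$. For $u\in N$, $\mathsf Z_P(u)=\{w\in\mathbb Z_{\ge0}^k: w_1p_1\oplus\dots\oplus w_kp_k=u\}$. Factorizations: $\mathsf Z_S(n)=\{z=(z_0,\dots,z_k)\in\mathbb Z_{\ge0}^{k+1}: n=z_0m+\sum_{i\ge1}z_in_i\}$, $\varphi_S(z)=z_0m+\sum_{i\ge1}z_in_i$. A presentation of $S$ is a set $\rho$ of ordered pairs $(z,z')$ with $\varphi_S(z)=\varphi_S(z')$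 such that the smallest congruence on $\mathbb Z_{\ge0}^{k+1}$ containing $\rho$ is $\ker\varphi_S$; minimal means minimal under inclusion. For $z\in\mathbb Z_{\ge0}^{k+1}$ write $\widehat z=(z_1,\dots,z_k)$ and $\overline z=z_1p_1+\dots+z_kp_k\in\mathbb Z_m$. A relation $(z,z')\in\rho$ is $m$-centric if $\widehat z\in\mathsf Z_P(\overline z)$, and $\rho$ is $m$-centric if all its relations are. -}

module Defs where

open import Data.Nat using (ℕ; zero; suc; _+_; _*_; _∸_; _≤_; _<_; NonZero)
open import Data.Nat.DivMod using (_%_)
open import Data.Bool using (Bool; true; false)
open import Data.Fin using (Fin)
open import Data.Vec using (Vec; []; _∷_; lookup; map; zipWith; head; tail)
open import Data.List using (List; []; _∷_; _++_; replicate)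
open import Data.Maybe using (Maybe; just; nothing)
open import Data.Product using (Σ; ∃; ∃-syntax; _×_; _,_)
open import Data.Sum using (_⊎_)
open import Relation.Binary.PropositionalEquality using (_≡_; _≢_)

_∈S_ : ℕ → (ℕ → Bool) → Set
n ∈S S = S n ≡ true

_∉S_ : ℕ → (ℕ → Bool) → Set
n ∉S S = S n ≡ false

record IsNumericalSemigroup (S : ℕ → Bool) : Set where
  field
    zero∈   : 0 ∈S S
    closed  : ∀ x y → x ∈S S → y ∈S S → (x + y) ∈S S
    cofinite : ∃[ F ] (∀ n → F ≤ n → n ∈S S)

IsMultiplicity : (ℕ → Bool) → ℕ → Set
IsMultiplicity S m = (0 < m) × (m ∈S S) × (∀ n → 0 < n → n ∈S S → m ≤ n)

IsMinimalGenerator : (ℕ → Bool) → ℕ → Set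
IsMinimalGenerator S n =
  (n ∈S S) × (0 < n) ×
  (∀ x y → x ∈S S → y ∈S S → x + y ≡ n → (x ≡ 0) ⊎ (y ≡ 0))

record MinimalGenerators (S : ℕ → Bool) (m : ℕ) {k : ℕ} (ns : Vec ℕ k) : Set where
  field
    increasing : ∀ (i j : Fin k) → Data.Fin._<_ i j → lookup ns i < lookup ns j
    above-m    : ∀ (i : Fin k) → m < lookup ns i
    m-gen      : IsMinimalGenerator S m
    gens       : ∀ (i : Fin k) → IsMinimalGenerator S (lookup ns i)
    complete   : ∀ n → IsMinimalGenerator S n → (n ≡ m) ⊎ (∃[ i ] lookup ns i ≡ n)

-- Apéry set Ap(S;m) = {n ∈ S : n - m ∉ S}   (n - m < 0 counts as ∉ S)

InApery : (ℕ → Bool) → ℕ → ℕ → Set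
InApery S m n = (n ∈S S) × (m ≤ n → (n ∸ m) ∉S S)

IsAperyElt : (S : ℕ → Bool) (m : ℕ) .{{_ : NonZero m}} → ℕ → ℕ → Set
IsAperyElt S m i a = InApery S m a × (a % m ≡ i)

-- Kunz nilsemigroup N = ℤ_m ∪ {∞}: residues are `just i` (i < m),
-- ∞ is `nothing`.  The operation ⊕ is given as a (functional) relation
-- NilAdd S m u v w  meaning  u ⊕ v = w.

N : Set
N = Maybe ℕ

data NilAdd (S : ℕ → Bool) (m : ℕ) .{{_ : NonZero m}} : N → N → N → Set where
  ∞ˡ  : ∀ u → NilAdd S m nothing u nothing
  ∞ʳ  : ∀ u → NilAdd S m u nothing nothing
  fin : ∀ i j ai aj aij →
        IsAperyElt S m i ai → IsAperyElt S m j aj →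
        IsAperyElt S m ((i + j) % m) aij →
        ai + aj ≡ aij →
        NilAdd S m (just i) (just j) (just ((i + j) % m))
  inf : ∀ i j ai aj aij →
        IsAperyElt S m i ai → IsAperyElt S m j aj →
        IsAperyElt S m ((i + j) % m) aij →
        ai + aj ≢ aij →
        NilAdd S m (just i) (just j) nothing

NilSum : (S : ℕ → Bool) (m : ℕ) .{{_ : NonZero m}} → List N → N → Set
NilSum S m []       r = r ≡ just 0
NilSum S m (u ∷ us) r = ∃[ s ] (NilSum S m us s × NilAdd S m u s r)

atomList : ∀ {k} → Vec ℕ k → Vec ℕ k → List N
atomList []       []       = []
atomList (w ∷ ws) (p ∷ ps) = replicate w (just p) ++ atomList ws ps

atoms : (m : ℕ) .{{_ : NonZero m}} → ∀ {k} → Vec ℕ k → Vec ℕ k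
atoms m ns = map (λ n → n % m) ns

InZP : (S : ℕ → Bool) (m : ℕ) .{{_ : NonZero m}} → ∀ {k} → Vec ℕ k →
       Vec ℕ k → N → Set
InZP S m ns w u = NilSum S m (atomList w (atoms m ns)) u

dot : ∀ {k} → Vec ℕ k → Vec ℕ k → ℕ
dot []       []       = 0
dot (x ∷ xs) (y ∷ ys) = x * y + dot xs ys

φ : (m : ℕ) → ∀ {k} → Vec ℕ k → Vec ℕ (suc k) → ℕ
φ m ns (z₀ ∷ ẑ) = z₀ * m + dot ẑ ns

zbar : (m : ℕ) .{{_ : NonZero m}} → ∀ {k} → Vec ℕ k → Vec ℕ (suc k) → ℕ
zbar m ns z = dot (tail z) (atoms m ns) % m

Relation : ℕ → Set₁
Relation k = Vec ℕ (suc k) → Vec ℕ (suc k) → Set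

data Cong {k : ℕ} (ρ : Relation k) : Vec ℕ (suc k) → Vec ℕ (suc k) → Set where
  gen   : ∀ {x y} → ρ x y → Cong ρ x y
  crefl : ∀ {x} → Cong ρ x x
  csym  : ∀ {x y} → Cong ρ x y → Cong ρ y x
  ctrans : ∀ {x y z} → Cong ρ x y → Cong ρ y z → Cong ρ x z
  cadd  : ∀ {x y} (w : Vec ℕ (suc k)) → Cong ρ x y →
          Cong ρ (zipWith _+_ x w) (zipWith _+_ y w)

record IsPresentation (m : ℕ) {k : ℕ} (ns : Vec ℕ k) (ρ : Relation k) : Set where
  field
    in-kernel : ∀ z z' → ρ z z' → φ m ns z ≡ φ m ns z'
    cong⊆ker  : ∀ z z' → Cong ρ z z' → φ m ns z ≡ φ m ns z'
    ker⊆cong  : ∀ z z' → φ m ns z ≡ φ m ns z' → Cong ρ z z'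

IsMinimalPresentation : (m : ℕ) → ∀ {k} → Vec ℕ k → Relation k → Set₁
IsMinimalPresentation m {k} ns ρ =
  IsPresentation m ns ρ ×
  (∀ (ρ' : Relation k) → (∀ z z' → ρ' z z' → ρ z z') →
     IsPresentation m ns ρ' → ∀ z z' → ρ z z' → ρ' z z')

IsMCentric : (S : ℕ → Bool) (m : ℕ) .{{_ : NonZero m}} → ∀ {k} → Vec ℕ k →
             Relation k → Set
IsMCentric S m ns ρ = ∀ z z' → ρ z z' → InZP S m ns (tail z) (just (zbar m ns z))

module Submission where

-- Factorizations of n are joined by an edge when their supports meet; the connected
-- components of this finite graph are the R-classes of n. Relating one chosen factorization
-- of each n to a representative of every other R-class of n gives a presentation (an edge
-- x′ + e ~ y′ + e descends to the smaller element φ(x′)), and a minimal one, since no other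
-- congruence step can enter or leave the R-class of that representative. Choosing the
-- factorization with the largest coefficient z₀ of m makes every relation m-centric: then
-- Σ ẑᵢnᵢ lies in Ap(S;m) (otherwise subtracting m and refactoring would raise z₀), and a sum
-- of Apéry generators is Apéry exactly when the Kunz sum of their atoms is finite. The same
-- equivalence gives (b): m-centricity puts φ(z) − z₀m in Ap(S;m), and adding a positive
-- multiple of m to an Apéry element leaves Ap(S;m).

open import Defs

import Algebra.Properties.CommutativeSemigroup as CommutativeSemigroupProperties
open import Data.Bool using (Bool; true)
import Data.Bool as Bool
open import Data.Bool.Properties using (¬-not)
open import Data.Empty using (⊥; ⊥-elim)
open import Data.Fin as Fin using (Fin)
open import Data.List using (List; []; _∷_; _++_; cartesianProductWith; upTo; filter)
import Data.List as List
open import Data.List.Extrema.Nat using (argmax; argmax-all; f[⊥]≤f[argmax]; f[xs]≤f[argmax])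
open import Data.List.Membership.Propositional using (_∈_)
open import Data.List.Membership.Propositional.Properties using (∈-cartesianProductWith⁺; ∈-upTo⁺; ∈-filter⁺)
open import Data.List.Properties using (filter-≐; map-++; map-replicate)
import Data.List.Relation.Unary.All as ListAll
open import Data.List.Relation.Unary.All.Properties using (all-filter; ++⁺; replicate⁺)
open import Data.List.Relation.Unary.Any using (here; there)
open import Data.Maybe using (just)
open import Data.Nat using (ℕ; zero; suc; _+_; _*_; _∸_; _≤_; _<_; z≤n; s≤s; NonZero; >-nonZero)
open import Data.Nat.DivMod using (_%_; _/_; m≡m%n+[m/n]*n; /-monoˡ-≤; %-distribˡ-+; %-distribˡ-*; m%n%n≡m%n; m*n%n≡0)
open import Data.Nat.Induction using (<-rec)
open import Data.Nat.ListAction using (sum)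
open import Data.Nat.ListAction.Properties using (sum-++)
open import Data.Nat.Properties
open import Data.Nat.Solver using (module +-*-Solver)
open import Data.Product using (Σ; ∃; ∃₂; _×_; _,_; proj₁; proj₂)
open import Data.Sum using (_⊎_; inj₁; inj₂; [_,_]′)
open import Data.Vec using (Vec; []; _∷_; head; tail; zipWith; replicate; lookup)
import Data.Vec as Vec
open import Data.Vec.Properties as Vecₚ using (zipWith-identityʳ)
open import Data.Vec.Relation.Unary.All as VAll using (All; []; _∷_)
open import Data.Vec.Relation.Unary.All.Properties using (lookup⁺; lookup⁻)
open import Function.Base using (_∘_)
open import Function.Bundles using (_⇔_; mk⇔; Equivalence)
open import Function.Properties.Equivalence using (⇔-isEquivalence)
open import Level using (0ℓ)
open import Relation.Binary.Construct.Closure.ReflexiveTransitive using (Star; ε; _◅_; _◅◅_; fold; reverse)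
open import Relation.Binary.Definitions using (Decidable; DecidableEquality)
open import Relation.Binary.PropositionalEquality using (_≡_; refl; sym; trans; cong; cong₂; subst; subst₂)
open import Relation.Binary.Structures using (IsEquivalence)
open import Relation.Nullary using (¬_; yes; no)
open import Relation.Nullary.Decidable using (_⊎-dec_; _×-dec_; map′)
open CommutativeSemigroupProperties +-commutativeSemigroup using (interchange; x∙yz≈y∙xz)
open Relation.Binary.PropositionalEquality.≡-Reasoning

infixl 6 _+ᵛ_

_+ᵛ_ : ∀ {n} → Vec ℕ n → Vec ℕ n → Vec ℕ n
_+ᵛ_ = zipWith _+_

0ᵛ : ∀ {n} → Vec ℕ n
0ᵛ = replicate _ 0

unitᵛ : ∀ {n} → Fin n → Vec ℕ n
unitᵛ Fin.zero    = 1 ∷ 0ᵛ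
unitᵛ (Fin.suc i) = 0 ∷ unitᵛ i

+ᵛ-identityʳ : ∀ {n} (x : Vec ℕ n) → x +ᵛ 0ᵛ ≡ x
+ᵛ-identityʳ = zipWith-identityʳ +-identityʳ

dot-0ᵛ : ∀ {n} (g : Vec ℕ n) → dot 0ᵛ g ≡ 0
dot-0ᵛ []      = refl
dot-0ᵛ (_ ∷ g) = dot-0ᵛ g

dot-unitᵛ : ∀ {n} (g : Vec ℕ n) i → dot (unitᵛ i) g ≡ lookup g i
dot-unitᵛ (c ∷ g) Fin.zero    = trans (cong₂ _+_ (+-identityʳ c) (dot-0ᵛ g)) (+-identityʳ c)
dot-unitᵛ (c ∷ g) (Fin.suc i) = dot-unitᵛ g i

dot-+ᵛ : ∀ {n} (x y g : Vec ℕ n) → dot (x +ᵛ y) g ≡ dot x g + dot y g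
dot-+ᵛ []      []      []      = refl
dot-+ᵛ (a ∷ x) (b ∷ y) (c ∷ g) = begin
  (a + b) * c + dot (x +ᵛ y) g           ≡⟨ cong₂ _+_ (*-distribʳ-+ c a b) (dot-+ᵛ x y g) ⟩
  (a * c + b * c) + (dot x g + dot y g)  ≡⟨ interchange (a * c) (b * c) (dot x g) (dot y g) ⟩
  (a * c + dot x g) + (b * c + dot y g)  ∎

SharesSupport : ∀ {n} → Vec ℕ n → Vec ℕ n → Set
SharesSupport []      []      = ⊥
SharesSupport (a ∷ x) (b ∷ y) = (0 < a × 0 < b) ⊎ SharesSupport x y

sharesSupport? : ∀ {n} → Decidable (SharesSupport {n})
sharesSupport? []      []      = no λ ()
sharesSupport? (a ∷ x) (b ∷ y) = ((0 <? a) ×-dec (0 <? b)) ⊎-dec sharesSupport? x y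

sharesSupport-sym : ∀ {n} {x y : Vec ℕ n} → SharesSupport x y → SharesSupport y x
sharesSupport-sym {x = []}    {[]}    ()
sharesSupport-sym {x = _ ∷ _} {_ ∷ _} (inj₁ (p , q)) = inj₁ (q , p)
sharesSupport-sym {x = _ ∷ _} {_ ∷ _} (inj₂ s)       = inj₂ (sharesSupport-sym s)

sharesSupport-+ᵛ : ∀ {n} (x y w : Vec ℕ n) → SharesSupport w w →
                   SharesSupport (x +ᵛ w) (y +ᵛ w)
sharesSupport-+ᵛ (a ∷ x) (b ∷ y) (c ∷ w) (inj₁ (0<c , _)) =
  inj₁ (<-≤-trans 0<c (m≤n+m c a) , <-≤-trans 0<c (m≤n+m c b))
sharesSupport-+ᵛ (a ∷ x) (b ∷ y) (c ∷ w) (inj₂ s) = inj₂ (sharesSupport-+ᵛ x y w s)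

¬selfSupport⇒0ᵛ : ∀ {n} (w : Vec ℕ n) → ¬ SharesSupport w w → w ≡ 0ᵛ
¬selfSupport⇒0ᵛ []          _ = refl
¬selfSupport⇒0ᵛ (zero ∷ w)  ¬s = cong (0 ∷_) (¬selfSupport⇒0ᵛ w (λ s → ¬s (inj₂ s)))
¬selfSupport⇒0ᵛ (suc c ∷ w) ¬s with () ← ¬s (inj₁ (s≤s z≤n , s≤s z≤n))

sharesSupport⇒commonUnit : ∀ {n} {x y : Vec ℕ n} → SharesSupport x y →
  ∃₂ λ x′ y′ → ∃ λ i → x ≡ x′ +ᵛ unitᵛ i × y ≡ y′ +ᵛ unitᵛ i
sharesSupport⇒commonUnit {x = []} {[]} ()
sharesSupport⇒commonUnit {x = suc a ∷ x} {suc b ∷ y} (inj₁ _) =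
  a ∷ x , b ∷ y , Fin.zero ,
  cong₂ _∷_ (+-comm 1 a) (sym (+ᵛ-identityʳ x)) ,
  cong₂ _∷_ (+-comm 1 b) (sym (+ᵛ-identityʳ y))
sharesSupport⇒commonUnit {x = a ∷ _} {b ∷ _} (inj₂ s)
  with x′ , y′ , i , refl , refl ← sharesSupport⇒commonUnit s =
  a ∷ x′ , b ∷ y′ , Fin.suc i , cong (_∷ _) (sym (+-identityʳ a)) , cong (_∷ _) (sym (+-identityʳ b))

vecsBoundedBy : ℕ → (n : ℕ) → List (Vec ℕ n)
vecsBoundedBy b zero    = [] ∷ []
vecsBoundedBy b (suc n) = cartesianProductWith _∷_ (upTo (suc b)) (vecsBoundedBy b n)

∈-vecsBoundedBy : ∀ b {n} {z : Vec ℕ n} → All (_≤ b) z → z ∈ vecsBoundedBy b n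
∈-vecsBoundedBy b []       = here refl
∈-vecsBoundedBy b (p ∷ ps) = ∈-cartesianProductWith⁺ _∷_ (∈-upTo⁺ (s≤s p)) (∈-vecsBoundedBy b ps)

entries≤dot : ∀ {n} {g : Vec ℕ n} → All (0 <_) g → (z : Vec ℕ n) → All (_≤ dot z g) z
entries≤dot             []         []      = []
entries≤dot {g = c ∷ g} (0<c ∷ g>0) (a ∷ z) =
  ≤-trans (m≤m*n a c {{>-nonZero 0<c}}) (m≤m+n (a * c) (dot z g)) ∷
  VAll.map (λ p → ≤-trans p (m≤n+m (dot z g) (a * c))) (entries≤dot g>0 z)

∈-vecsBoundedBy-dot : ∀ {n} {g : Vec ℕ n} → All (0 <_) g → (z : Vec ℕ n) →
                      z ∈ vecsBoundedBy (dot z g) n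
∈-vecsBoundedBy-dot g>0 z = ∈-vecsBoundedBy _ (entries≤dot g>0 z)

-- Warshall's algorithm: `Via vs x y` allows only vertices of vs as intermediate stops.
module FiniteReachability {V : Set} (_≟ᵛ_ : DecidableEquality V)
                          (E : V → V → Set) (E? : Decidable E) where

  Via : List V → V → V → Set
  Via []       x y = x ≡ y ⊎ E x y
  Via (v ∷ vs) x y = Via vs x y ⊎ (Via vs x v × Via vs v y)

  via? : ∀ vs → Decidable (Via vs)
  via? []       x y = (x ≟ᵛ y) ⊎-dec E? x y
  via? (v ∷ vs) x y = via? vs x y ⊎-dec (via? vs x v ×-dec via? vs v y)

  via⇒star : ∀ vs {x y} → Via vs x y → Star E x y
  via⇒star []       (inj₁ refl)    = ε
  via⇒star []       (inj₂ e)       = e ◅ ε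
  via⇒star (v ∷ vs) (inj₁ p)       = via⇒star vs p
  via⇒star (v ∷ vs) (inj₂ (p , q)) = via⇒star vs p ◅◅ via⇒star vs q

  via-step : ∀ vs {x y} → x ≡ y ⊎ E x y → Via vs x y
  via-step []       s = s
  via-step (v ∷ vs) s = inj₁ (via-step vs s)

  via-trans : ∀ {vs x w y} → w ∈ vs → Via vs x w → Via vs w y → Via vs x y
  via-trans {v ∷ vs} {x} {y = y} (here refl) p q = inj₂ (toV p , fromV q)
    where
    toV : Via (v ∷ vs) x v → Via vs x v
    toV (inj₁ a)       = a
    toV (inj₂ (a , _)) = a
    fromV : Via (v ∷ vs) v y → Via vs v y
    fromV (inj₁ a)       = a
    fromV (inj₂ (_ , a)) = a
  via-trans (there w∈) (inj₁ a)       (inj₁ b)       = inj₁ (via-trans w∈ a b)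
  via-trans (there w∈) (inj₁ a)       (inj₂ (b , c)) = inj₂ (via-trans w∈ a b , c)
  via-trans (there w∈) (inj₂ (a , b)) (inj₁ c)       = inj₂ (a , via-trans w∈ b c)
  via-trans (there w∈) (inj₂ (a , _)) (inj₂ (_ , d)) = inj₂ (a , d)

  star⇒via : ∀ {vs x y} → (∀ {w} → Star E x w → w ∈ vs) → Star E x y → Via vs x y
  star⇒via {vs} _      ε       = via-step vs (inj₁ refl)
  star⇒via {vs} closed (e ◅ p) =
    via-trans (closed (e ◅ ε)) (via-step vs (inj₂ e)) (star⇒via (λ q → closed (e ◅ q)) p)

  star? : (enum : V → List V) → (∀ {x w} → Star E x w → w ∈ enum x) → Decidable (Star E)
  star? enum closed x y = map′ (via⇒star (enum x)) (star⇒via closed) (via? (enum x) x y)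

firstOr : ∀ {A : Set} → A → List A → A
firstOr d []      = d
firstOr d (x ∷ _) = x

firstOr-All : ∀ {A : Set} {P : A → Set} {d xs} → P d → ListAll.All P xs → P (firstOr d xs)
firstOr-All pd ListAll.[]      = pd
firstOr-All _  (px ListAll.∷ _) = px

firstOr-default-irrelevant : ∀ {A : Set} {x : A} {xs} d d′ → x ∈ xs → firstOr d xs ≡ firstOr d′ xs
firstOr-default-irrelevant _ _ (here _)  = refl
firstOr-default-irrelevant _ _ (there _) = refl

maxHead : ∀ {n} → List (Vec ℕ (suc n)) → Vec ℕ (suc n)
maxHead []       = 0ᵛ
maxHead (z ∷ zs) = argmax head z zs

maxHead-All : ∀ {n} {P : Vec ℕ (suc n) → Set} {z zs} → z ∈ zs → ListAll.All P zs → P (maxHead zs)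
maxHead-All _ (pz ListAll.∷ pzs) = argmax-all head pz pzs

head≤maxHead : ∀ {n} {z : Vec ℕ (suc n)} {zs} → z ∈ zs → head z ≤ head (maxHead zs)
head≤maxHead {zs = z ∷ zs} (here refl) = f[⊥]≤f[argmax] {f = head} z zs
head≤maxHead {zs = z ∷ zs} (there z∈)  = ListAll.lookup (f[xs]≤f[argmax] {f = head} z zs) z∈

module FactorizationGraph {n} (g : Vec ℕ n) (g>0 : All (0 <_) g) where

  Φ : Vec ℕ n → ℕ
  Φ z = dot z g

  Edge : Vec ℕ n → Vec ℕ n → Set
  Edge x y = Φ x ≡ Φ y × SharesSupport x y

  Reach : Vec ℕ n → Vec ℕ n → Set
  Reach = Star Edge

  reach-Φ : ∀ {x y} → Reach x y → Φ x ≡ Φ y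
  reach-Φ = fold (λ x y → Φ x ≡ Φ y) (λ e p → trans (proj₁ e) p) refl

  reach-sym : ∀ {x y} → Reach x y → Reach y x
  reach-sym = reverse (λ (e , s) → sym e , sharesSupport-sym s)

  reach? : Decidable Reach
  reach? = star? (λ x → vecsBoundedBy (Φ x) n)
                 (λ r → subst (λ b → _ ∈ vecsBoundedBy b n) (sym (reach-Φ r)) (∈-vecsBoundedBy-dot g>0 _))
    where open FiniteReachability (Vecₚ.≡-dec _≟_) Edge (λ x y → (Φ x ≟ Φ y) ×-dec sharesSupport? x y)

  reachers : Vec ℕ n → List (Vec ℕ n)
  reachers z = filter (λ w → reach? w z) (vecsBoundedBy (Φ z) n)

  repr : Vec ℕ n → Vec ℕ n
  repr z = firstOr z (reachers z)

  repr-reach : ∀ z → Reach (repr z) z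
  repr-reach z = firstOr-All ε (all-filter (λ w → reach? w z) (vecsBoundedBy (Φ z) n))

  repr-cong : ∀ {x y} → Reach x y → repr x ≡ repr y
  repr-cong {x} {y} r = begin
    firstOr x (reachers x)  ≡⟨ firstOr-default-irrelevant x y x∈ ⟩
    firstOr y (reachers x)  ≡⟨ cong (firstOr y) reachers-eq ⟩
    firstOr y (reachers y)  ∎
    where
    x∈ : x ∈ reachers x
    x∈ = ∈-filter⁺ (λ w → reach? w x) (∈-vecsBoundedBy-dot g>0 x) ε
    reachers-eq : reachers x ≡ reachers y
    reachers-eq rewrite reach-Φ r =
      filter-≐ (λ w → reach? w x) (λ w → reach? w y) ((_◅◅ r) , (_◅◅ reach-sym r)) (vecsBoundedBy (Φ y) n)

  repr-idem : ∀ z → repr (repr z) ≡ repr z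
  repr-idem z = repr-cong (repr-reach z)

module CanonicalPresentation (m : ℕ) {k} (ns : Vec ℕ k) (g>0 : All (0 <_) (m ∷ ns))
    (choose : ℕ → Vec ℕ (suc k))
    (Φ-choose : ∀ z → dot (choose (dot z (m ∷ ns))) (m ∷ ns) ≡ dot z (m ∷ ns)) where

  open FactorizationGraph (m ∷ ns) g>0 public

  ρ : Relation k
  ρ u v = u ≡ choose (Φ v) × v ≡ repr v × ¬ Reach v u

  φ≡Φ : ∀ z → φ m ns z ≡ Φ z
  φ≡Φ (_ ∷ _) = refl

  ρ⊆kerΦ : ∀ {u v} → ρ u v → Φ u ≡ Φ v
  ρ⊆kerΦ {v = v} (refl , _ , _) = Φ-choose v

  Cong⊆kerΦ : ∀ {R : Relation k} → (∀ {u v} → R u v → Φ u ≡ Φ v) →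
              ∀ {x y} → Cong R x y → Φ x ≡ Φ y
  Cong⊆kerΦ R⊆ker (gen r)     = R⊆ker r
  Cong⊆kerΦ R⊆ker crefl       = refl
  Cong⊆kerΦ R⊆ker (csym p)    = sym (Cong⊆kerΦ R⊆ker p)
  Cong⊆kerΦ R⊆ker (ctrans p q) = trans (Cong⊆kerΦ R⊆ker p) (Cong⊆kerΦ R⊆ker q)
  Cong⊆kerΦ R⊆ker (cadd {x} {y} w p) = begin
    Φ (x +ᵛ w)   ≡⟨ dot-+ᵛ x w (m ∷ ns) ⟩
    Φ x + Φ w    ≡⟨ cong (_+ Φ w) (Cong⊆kerΦ R⊆ker p) ⟩
    Φ y + Φ w    ≡⟨ dot-+ᵛ y w (m ∷ ns) ⟨
    Φ (y +ᵛ w)   ∎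

  -- An edge x ~ y is x′ + e ~ y′ + e with Φ x′ < Φ x, so strong induction on Φ applies.
  kerΦ⊆Congρ : ∀ b {x y} → Φ x ≡ b → Φ y ≡ b → Cong ρ x y
  kerΦ⊆Congρ = <-rec _ λ b ih {x} {y} x≡b y≡b →
                 ctrans (to-chosen b ih x≡b) (csym (to-chosen b ih y≡b))
    where
    Below : ℕ → Set
    Below b = ∀ {c} → c < b → ∀ {x y} → Φ x ≡ c → Φ y ≡ c → Cong ρ x y

    edge⇒Cong : ∀ b → Below b → ∀ {x y} → Edge x y → Φ x ≡ b → Cong ρ x y
    edge⇒Cong b ih (Φx≡Φy , s) Φx≡b with x′ , y′ , i , refl , refl ← sharesSupport⇒commonUnit s =
      cadd (unitᵛ i) (ih Φx′<b refl Φy′≡Φx′)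
      where
      Φ-split : ∀ z → Φ (z +ᵛ unitᵛ i) ≡ Φ z + lookup (m ∷ ns) i
      Φ-split z = trans (dot-+ᵛ z (unitᵛ i) (m ∷ ns)) (cong (Φ z +_) (dot-unitᵛ (m ∷ ns) i))
      Φx′<b : Φ x′ < b
      Φx′<b = subst (Φ x′ <_) (trans (sym (Φ-split x′)) Φx≡b) (m<m+n (Φ x′) (lookup⁺ g>0 i))
      Φy′≡Φx′ : Φ y′ ≡ Φ x′
      Φy′≡Φx′ = +-cancelʳ-≡ _ (Φ y′) (Φ x′) (trans (sym (Φ-split y′)) (trans (sym Φx≡Φy) (Φ-split x′)))

    reach⇒Cong : ∀ b → Below b → ∀ {x y} → Reach x y → Φ x ≡ b → Cong ρ x y
    reach⇒Cong b ih ε         _    = crefl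
    reach⇒Cong b ih (e ◅ r) Φx≡b =
      ctrans (edge⇒Cong b ih e Φx≡b) (reach⇒Cong b ih r (trans (sym (proj₁ e)) Φx≡b))

    to-chosen : ∀ b → Below b → ∀ {z} → Φ z ≡ b → Cong ρ z (choose b)
    to-chosen b ih {z} Φz≡b =
      ctrans (csym (reach⇒Cong b ih (repr-reach z) Φr≡b)) repr-to-chosen
      where
      Φr≡b : Φ (repr z) ≡ b
      Φr≡b = trans (reach-Φ (repr-reach z)) Φz≡b
      repr-to-chosen : Cong ρ (repr z) (choose b)
      repr-to-chosen with reach? (repr z) (choose b)
      ... | yes r = reach⇒Cong b ih r Φr≡b
      ... | no ¬r = csym (gen (cong choose (sym Φr≡b) , sym (repr-idem z) , ¬r))

  ρ-isPresentation : IsPresentation m ns ρ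
  ρ-isPresentation = record
    { in-kernel = λ z z′ r → trans (φ≡Φ z) (trans (ρ⊆kerΦ r) (sym (φ≡Φ z′)))
    ; cong⊆ker  = λ z z′ c → trans (φ≡Φ z) (trans (Cong⊆kerΦ ρ⊆kerΦ c) (sym (φ≡Φ z′)))
    ; ker⊆cong  = λ z z′ e → kerΦ⊆Congρ (Φ z) refl (trans (sym (φ≡Φ z′)) (trans (sym e) (φ≡Φ z)))
    }

  -- Unless ρ′ contains u ρ v, every ρ′-congruence step keeps both ends on the same side
  -- of the R-class of v; as u lies outside that class, u ρ v must be in ρ′.
  module _ (ρ′ : Relation k) (ρ′⊆ρ : ∀ z z′ → ρ′ z z′ → ρ z z′)
           {u v} (uρv : ρ u v) where

    private
      open IsEquivalence (⇔-isEquivalence {ℓ = 0ℓ})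
        using () renaming (refl to ⇔-refl; sym to ⇔-sym; trans to ⇔-trans)

      u≡chosen : u ≡ choose (Φ v)
      u≡chosen = proj₁ uρv

      v≡repr : v ≡ repr v
      v≡repr = proj₁ (proj₂ uρv)

      ¬v↝u : ¬ Reach v u
      ¬v↝u = proj₂ (proj₂ uρv)

      ρ′⊆kerΦ : ∀ {a b} → ρ′ a b → Φ a ≡ Φ b
      ρ′⊆kerΦ {a} {b} r = ρ⊆kerΦ (ρ′⊆ρ a b r)

    Congρ′-separates : ∀ {x y} → Cong ρ′ x y → ρ′ u v ⊎ (Reach x v ⇔ Reach y v)
    Congρ′-separates (gen {a} {b} r) with ρ′⊆ρ a b r | Vecₚ.≡-dec _≟_ b v
    ... | a≡chosen , _ , _ | yes refl = inj₁ (subst (λ t → ρ′ t v) (trans a≡chosen (sym u≡chosen)) r)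
    ... | a≡chosen , b≡repr , _ | no b≢v = inj₂ (mk⇔ (⊥-elim ∘ ¬a↝v) (⊥-elim ∘ ¬b↝v))
      where
      ¬a↝v : ¬ Reach a v
      ¬a↝v a↝v = ¬v↝u (subst (Reach v) a≡u (reach-sym a↝v))
        where
        a≡u : a ≡ u
        a≡u = trans a≡chosen (trans (cong choose (trans (sym (ρ′⊆kerΦ r)) (reach-Φ a↝v))) (sym u≡chosen))
      ¬b↝v : ¬ Reach b v
      ¬b↝v b↝v = b≢v (trans b≡repr (trans (repr-cong b↝v) (sym v≡repr)))
    Congρ′-separates crefl = inj₂ ⇔-refl
    Congρ′-separates (csym p) with Congρ′-separates p
    ... | inj₁ r = inj₁ r
    ... | inj₂ e = inj₂ (⇔-sym e)
    Congρ′-separates (ctrans p q) with Congρ′-separates p | Congρ′-separates q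
    ... | inj₁ r | _      = inj₁ r
    ... | inj₂ _ | inj₁ r = inj₁ r
    ... | inj₂ e | inj₂ f = inj₂ (⇔-trans e f)
    Congρ′-separates (cadd {x} {y} w p) with sharesSupport? w w
    ... | yes s = inj₂ (mk⇔ (reach-sym edge ◅◅_) (edge ◅◅_))
      where
      edge : Reach (x +ᵛ w) (y +ᵛ w)
      edge = (Cong⊆kerΦ ρ′⊆kerΦ (cadd w p) , sharesSupport-+ᵛ x y w s) ◅ ε
    ... | no ¬s with refl ← ¬selfSupport⇒0ᵛ w ¬s | Congρ′-separates p
    ... | inj₁ r = inj₁ r
    ... | inj₂ e = inj₂ (subst₂ (λ a b → Reach a v ⇔ Reach b v)
                                (sym (+ᵛ-identityʳ x)) (sym (+ᵛ-identityʳ y)) e)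

  ρ-minimal : ∀ (ρ′ : Relation k) → (∀ z z′ → ρ′ z z′ → ρ z z′) →
              IsPresentation m ns ρ′ → ∀ z z′ → ρ z z′ → ρ′ z z′
  ρ-minimal ρ′ ρ′⊆ρ ρ′-pres u v uρv@(_ , _ , ¬v↝u)
    with Congρ′-separates ρ′ ρ′⊆ρ uρv
           (IsPresentation.ker⊆cong ρ′-pres u v (IsPresentation.in-kernel ρ-isPresentation u v uρv))
  ... | inj₁ u⟨ρ′⟩v = u⟨ρ′⟩v
  ... | inj₂ e      = ⊥-elim (¬v↝u (reach-sym (Equivalence.from e ε)))

replicateEach : ∀ {k} → Vec ℕ k → Vec ℕ k → List ℕ
replicateEach []       []       = []
replicateEach (w ∷ ws) (x ∷ xs) = List.replicate w x ++ replicateEach ws xs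

sum-replicateEach : ∀ {k} (w xs : Vec ℕ k) → sum (replicateEach w xs) ≡ dot w xs
sum-replicateEach []       []       = refl
sum-replicateEach (w ∷ ws) (x ∷ xs) = begin
  sum (List.replicate w x ++ replicateEach ws xs)
    ≡⟨ sum-++ (List.replicate w x) _ ⟩
  sum (List.replicate w x) + sum (replicateEach ws xs)
    ≡⟨ cong₂ _+_ (sum-replicate w) (sum-replicateEach ws xs) ⟩
  w * x + dot ws xs ∎
  where
  sum-replicate : ∀ w → sum (List.replicate w x) ≡ w * x
  sum-replicate zero    = refl
  sum-replicate (suc w) = cong (x +_) (sum-replicate w)

replicateEach⁺ : ∀ {k} {P : ℕ → Set} (w : Vec ℕ k) {xs} → All P xs → ListAll.All P (replicateEach w xs)
replicateEach⁺ []       []         = ListAll.[]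
replicateEach⁺ (w ∷ ws) (px ∷ pxs) = ++⁺ (replicate⁺ w px) (replicateEach⁺ ws pxs)

atomList-map : ∀ {k} (f : ℕ → ℕ) (w xs : Vec ℕ k) →
               atomList w (Vec.map f xs) ≡ List.map (λ x → just (f x)) (replicateEach w xs)
atomList-map f []       []       = refl
atomList-map f (w ∷ ws) (x ∷ xs) = begin
  List.replicate w (just (f x)) ++ atomList ws (Vec.map f xs)
    ≡⟨ cong₂ _++_ (sym (map-replicate just′ w x)) (atomList-map f ws xs) ⟩
  List.map just′ (List.replicate w x) ++ List.map just′ (replicateEach ws xs)
    ≡⟨ map-++ just′ (List.replicate w x) _ ⟨
  List.map just′ (List.replicate w x ++ replicateEach ws xs) ∎
  where
  just′ : ℕ → N
  just′ x = just (f x)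

dot-%ʳ : ∀ {k} m .{{_ : NonZero m}} (w xs : Vec ℕ k) → dot w (Vec.map (_% m) xs) % m ≡ dot w xs % m
dot-%ʳ m []       []       = refl
dot-%ʳ m (w ∷ ws) (x ∷ xs) = begin
  (w * (x % m) + dot ws (Vec.map (_% m) xs)) % m
    ≡⟨ %-distribˡ-+ (w * (x % m)) _ m ⟩
  ((w * (x % m)) % m + dot ws (Vec.map (_% m) xs) % m) % m
    ≡⟨ cong₂ (λ a b → (a + b) % m) w*x%≡ (dot-%ʳ m ws xs) ⟩
  ((w * x) % m + dot ws xs % m) % m
    ≡⟨ %-distribˡ-+ (w * x) (dot ws xs) m ⟨
  (w * x + dot ws xs) % m ∎
  where
  w*x%≡ : (w * (x % m)) % m ≡ (w * x) % m
  w*x%≡ = begin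
    (w * (x % m)) % m          ≡⟨ %-distribˡ-* w (x % m) m ⟩
    ((w % m) * (x % m % m)) % m ≡⟨ cong (λ t → ((w % m) * t) % m) (m%n%n≡m%n x m) ⟩
    ((w % m) * (x % m)) % m     ≡⟨ %-distribˡ-* w x m ⟨
    (w * x) % m                ∎

%≡⇒+* : ∀ {a b} m .{{_ : NonZero m}} → a % m ≡ b % m → a ≤ b → ∃ λ d → b ≡ a + d * m
%≡⇒+* {a} {b} m a%≡b% a≤b = d , (begin
  b                                  ≡⟨ m≡m%n+[m/n]*n b m ⟩
  b % m + b / m * m                  ≡⟨ cong₂ (λ r q → r + q * m) (sym a%≡b%) (sym (m+[n∸m]≡n a/≤b/)) ⟩
  a % m + (a / m + d) * m            ≡⟨ cong (a % m +_) (*-distribʳ-+ m (a / m) d) ⟩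
  a % m + (a / m * m + d * m)        ≡⟨ +-assoc (a % m) _ _ ⟨
  (a % m + a / m * m) + d * m        ≡⟨ cong (_+ d * m) (m≡m%n+[m/n]*n a m) ⟨
  a + d * m                          ∎)
  where
  a/≤b/ : a / m ≤ b / m
  a/≤b/ = /-monoˡ-≤ m a≤b
  d : ℕ
  d = b / m ∸ a / m

module NumericalSemigroup (S : ℕ → Bool) (isNS : IsNumericalSemigroup S)
                          (m : ℕ) .{{_ : NonZero m}} (mult : IsMultiplicity S m) where

  open IsNumericalSemigroup isNS

  m>0 : 0 < m
  m>0 = proj₁ mult

  m∈S : m ∈S S
  m∈S = proj₁ (proj₂ mult)

  ∈S⇒¬∉S : ∀ {n} → n ∈S S → ¬ n ∉S S
  ∈S⇒¬∉S n∈S n∉S with () ← trans (sym n∈S) n∉S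

  *-∈S : ∀ t {a} → a ∈S S → (t * a) ∈S S
  *-∈S zero    _   = zero∈
  *-∈S (suc t) a∈S = closed _ _ a∈S (*-∈S t a∈S)

  apery-intro : ∀ {b} → b ∈S S → (m ≤ b → ¬ (b ∸ m) ∈S S) → InApery S m b
  apery-intro b∈S below = b∈S , λ m≤b → ¬-not (below m≤b)

  apery-+*m : ∀ {a b} d → InApery S m b → a ∈S S → b ≡ a + d * m → d ≡ 0
  apery-+*m zero    _              _   _ = refl
  apery-+*m {a} {b} (suc d) (_ , b∸m∉S) a∈S b≡ =
    ⊥-elim (∈S⇒¬∉S (subst (_∈S S) (sym b∸m≡) (closed a (d * m) a∈S (*-∈S d m∈S))) (b∸m∉S m≤b))
    where
    b≡m+ : b ≡ m + (a + d * m)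
    b≡m+ = trans b≡ (x∙yz≈y∙xz a m (d * m))
    m≤b : m ≤ b
    m≤b = subst (m ≤_) (sym b≡m+) (m≤m+n m _)
    b∸m≡ : b ∸ m ≡ a + d * m
    b∸m≡ = trans (cong (_∸ m) b≡m+) (m+n∸m≡n m _)

  apery-unique-≤ : ∀ {a b} → InApery S m a → InApery S m b → a % m ≡ b % m → a ≤ b → b ≡ a
  apery-unique-≤ {a} aAp bAp a%≡b% a≤b with d , b≡ ← %≡⇒+* m a%≡b% a≤b =
    trans b≡ (trans (cong (λ t → a + t * m) (apery-+*m d bAp (proj₁ aAp) b≡)) (+-identityʳ a))

  apery-unique : ∀ {a b} → InApery S m a → InApery S m b → a % m ≡ b % m → a ≡ b
  apery-unique {a} {b} aAp bAp a%≡b% with ≤-total a b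
  ... | inj₁ a≤b = sym (apery-unique-≤ aAp bAp a%≡b% a≤b)
  ... | inj₂ b≤a = apery-unique-≤ bAp aAp (sym a%≡b%) b≤a

  apery-summandʳ : ∀ {a b} → a ∈S S → b ∈S S → InApery S m (a + b) → InApery S m b
  apery-summandʳ {a} {b} a∈S b∈S (_ , a+b∸m∉S) = apery-intro b∈S λ m≤b b∸m∈S →
    ∈S⇒¬∉S (subst (_∈S S) (sym (+-∸-assoc a m≤b)) (closed a _ a∈S b∸m∈S))
           (a+b∸m∉S (≤-trans m≤b (m≤n+m b a)))

  0∈Ap : InApery S m 0
  0∈Ap = zero∈ , λ m≤0 → ⊥-elim (<⇒≱ m>0 m≤0)

  residue : ℕ → N
  residue a = just (a % m)

  sum-∈S : ∀ {as} → ListAll.All (_∈S S) as → sum as ∈S S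
  sum-∈S ListAll.[]         = zero∈
  sum-∈S (a∈S ListAll.∷ as∈S) = closed _ _ a∈S (sum-∈S as∈S)

  kunzSum⁺ : ∀ {as} → ListAll.All (InApery S m) as → InApery S m (sum as) →
             NilSum S m (List.map residue as) (just (sum as % m))
  kunzSum⁺ ListAll.[] _ = cong just (m*n%n≡0 0 m)
  kunzSum⁺ {a ∷ as} (aAp ListAll.∷ asAp) sumAp =
    just (sum as % m) , kunzSum⁺ asAp restAp ,
    subst (λ r → NilAdd S m (residue a) (residue (sum as)) (just r)) (sym (%-distribˡ-+ a (sum as) m))
          (fin _ _ a (sum as) (a + sum as) (aAp , refl) (restAp , refl)
               (sumAp , %-distribˡ-+ a (sum as) m) refl)
    where
    restAp : InApery S m (sum as)
    restAp = apery-summandʳ (proj₁ aAp) (sum-∈S (ListAll.map proj₁ asAp)) sumAp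

  kunzSum⁻ : ∀ {as} → ListAll.All (InApery S m) as → ∀ {r} →
             NilSum S m (List.map residue as) (just r) → InApery S m (sum as) × sum as % m ≡ r
  kunzSum⁻ ListAll.[] refl = 0∈Ap , m*n%n≡0 0 m
  kunzSum⁻ {a ∷ as} (aAp ListAll.∷ asAp)
           (just j , rest , fin _ _ aᵢ aⱼ aᵢⱼ (aᵢAp , aᵢ%) (aⱼAp , aⱼ%) (aᵢⱼAp , aᵢⱼ%) aᵢ+aⱼ≡aᵢⱼ)
    with restAp , rest% ← kunzSum⁻ asAp rest =
    subst (InApery S m) aᵢⱼ≡ aᵢⱼAp , trans (cong (_% m) (sym aᵢⱼ≡)) aᵢⱼ%
    where
    aᵢⱼ≡ : aᵢⱼ ≡ a + sum as
    aᵢⱼ≡ = trans (sym aᵢ+aⱼ≡aᵢⱼ) (cong₂ _+_ (apery-unique aᵢAp aAp aᵢ%)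
                                          (apery-unique aⱼAp restAp (trans aⱼ% (sym rest%))))

  module _ {k} {ns : Vec ℕ k} (ns∈Ap : All (InApery S m) ns) where

    apery⇒inZP : ∀ w → InApery S m (dot w ns) → InZP S m ns w (just (dot w (atoms m ns) % m))
    apery⇒inZP w ap = subst₂ (NilSum S m) (sym (atomList-map (_% m) w ns))
      (cong just (trans (cong (_% m) (sum-replicateEach w ns)) (sym (dot-%ʳ m w ns))))
      (kunzSum⁺ (replicateEach⁺ w ns∈Ap) (subst (InApery S m) (sym (sum-replicateEach w ns)) ap))

    inZP⇒apery : ∀ w {r} → InZP S m ns w (just r) → InApery S m (dot w ns)
    inZP⇒apery w {r} w∈ZP = subst (InApery S m) (sum-replicateEach w ns)
      (proj₁ (kunzSum⁻ (replicateEach⁺ w ns∈Ap)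
                       (subst (λ l → NilSum S m l (just r)) (atomList-map (_% m) w ns) w∈ZP)))

  dot-∈S : ∀ {k} {xs : Vec ℕ k} → All (_∈S S) xs → ∀ w → dot w xs ∈S S
  dot-∈S []           []       = zero∈
  dot-∈S (x∈S ∷ xs∈S) (w ∷ ws) = closed _ _ (*-∈S w x∈S) (dot-∈S xs∈S ws)

  minimalGenerator-apery : ∀ {n} → IsMinimalGenerator S n → m < n → InApery S m n
  minimalGenerator-apery {n} (n∈S , _ , indecomposable) m<n = apery-intro n∈S λ m≤n n∸m∈S →
    [ (λ m≡0 → <⇒≢ m>0 (sym m≡0)) , m>n⇒m∸n≢0 m<n ]′
      (indecomposable m (n ∸ m) m∈S n∸m∈S (m+[n∸m]≡n m≤n))

  minimalGenerator-or-sum : ∀ n → 0 < n → n ∈S S →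
    IsMinimalGenerator S n ⊎ ∃ λ x → x < n × 0 < x × x ∈S S × (n ∸ x) ∈S S
  minimalGenerator-or-sum n n>0 n∈S
    with anyUpTo? (λ x → (0 <? x) ×-dec (S x Bool.≟ true) ×-dec (S (n ∸ x) Bool.≟ true)) n
  ... | yes split = inj₂ split
  ... | no ¬split = inj₁ (n∈S , n>0 , indecomposable)
    where
    indecomposable : ∀ x y → x ∈S S → y ∈S S → x + y ≡ n → x ≡ 0 ⊎ y ≡ 0
    indecomposable x y x∈S y∈S x+y≡n with x ≟ 0 | y ≟ 0
    ... | yes x≡0 | _       = inj₁ x≡0
    ... | no _    | yes y≡0 = inj₂ y≡0
    ... | no x≢0  | no y≢0  = ⊥-elim (¬split (x , x<n , n≢0⇒n>0 x≢0 , x∈S , n∸x∈S))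
      where
      x<n : x < n
      x<n = subst (x <_) x+y≡n (m<m+n x (n≢0⇒n>0 y≢0))
      n∸x∈S : (n ∸ x) ∈S S
      n∸x∈S = subst (_∈S S) (trans (sym (m+n∸m≡n x y)) (cong (_∸ x) x+y≡n)) y∈S

  apery-+-multiple : ∀ {b} t → InApery S m b → (0 < t) ⇔ (¬ InApery S m (t * m + b))
  apery-+-multiple {b} t bAp = mk⇔ to (from t)
    where
    to : 0 < t → ¬ InApery S m (t * m + b)
    to t>0 shiftedAp = <⇒≢ t>0 (sym (apery-+*m t shiftedAp (proj₁ bAp) (+-comm (t * m) b)))
    from : ∀ t → ¬ InApery S m (t * m + b) → 0 < t
    from zero    ¬bAp = ⊥-elim (¬bAp bAp)
    from (suc _) _    = s≤s z≤n

  mCentric⇒apery : ∀ {k} {ns : Vec ℕ k} → All (InApery S m) ns → ∀ {ρ} → IsMCentric S m ns ρ →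
    ∀ z z′ → ρ z z′ → InApery S m (φ m ns z ∸ head z * m) × ((0 < head z) ⇔ (¬ InApery S m (φ m ns z)))
  mCentric⇒apery {ns = ns} ns∈Ap centric z@(z₀ ∷ ẑ) z′ zρz′ =
    subst (InApery S m) (sym (m+n∸m≡n (z₀ * m) (dot ẑ ns))) ẑAp , apery-+-multiple z₀ ẑAp
    where
    ẑAp : InApery S m (dot ẑ ns)
    ẑAp = inZP⇒apery ns∈Ap ẑ (centric z z′ zρz′)

  module Generators {k} {ns : Vec ℕ k} (mg : MinimalGenerators S m ns) where
    open MinimalGenerators mg

    g>0 : All (0 <_) (m ∷ ns)
    g>0 = m>0 ∷ lookup⁻ (λ i → <-trans m>0 (above-m i))

    ns∈Ap : All (InApery S m) ns
    ns∈Ap = lookup⁻ (λ i → minimalGenerator-apery (gens i) (above-m i))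

    Φ : Vec ℕ (suc k) → ℕ
    Φ z = dot z (m ∷ ns)

    factorization : ∀ n → n ∈S S → ∃ λ z → Φ z ≡ n
    factorization = <-rec _ step
      where
      step : ∀ n → (∀ {x} → x < n → x ∈S S → ∃ λ z → Φ z ≡ x) → n ∈S S → ∃ λ z → Φ z ≡ n
      step zero    _  _   = 0ᵛ , dot-0ᵛ (m ∷ ns)
      step (suc n) ih n∈S with minimalGenerator-or-sum (suc n) (s≤s z≤n) n∈S
      ... | inj₂ (x , x<n , x>0 , x∈S , n∸x∈S)
        with zx , Φzx≡x ← ih x<n x∈S | zy , Φzy≡n∸x ← ih (∸-monoʳ-< x>0 (<⇒≤ x<n)) n∸x∈S =
        zx +ᵛ zy , (begin
          Φ (zx +ᵛ zy)       ≡⟨ dot-+ᵛ zx zy (m ∷ ns) ⟩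
          Φ zx + Φ zy        ≡⟨ cong₂ _+_ Φzx≡x Φzy≡n∸x ⟩
          x + (suc n ∸ x)    ≡⟨ m+[n∸m]≡n (<⇒≤ x<n) ⟩
          suc n              ∎)
      ... | inj₁ atom with complete (suc n) atom
      ... | inj₁ n≡m       = unitᵛ Fin.zero , trans (dot-unitᵛ (m ∷ ns) Fin.zero) (sym n≡m)
      ... | inj₂ (i , nᵢ≡n) = unitᵛ (Fin.suc i) , trans (dot-unitᵛ (m ∷ ns) (Fin.suc i)) nᵢ≡n

    factorizationsOf : ℕ → List (Vec ℕ (suc k))
    factorizationsOf b = filter (λ z → Φ z ≟ b) (vecsBoundedBy b (suc k))

    choose : ℕ → Vec ℕ (suc k)
    choose b = maxHead (factorizationsOf b)

    ∈-factorizationsOf : ∀ z → z ∈ factorizationsOf (Φ z)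
    ∈-factorizationsOf z = ∈-filter⁺ (λ y → Φ y ≟ Φ z) (∈-vecsBoundedBy-dot g>0 z) refl

    Φ-choose : ∀ z → Φ (choose (Φ z)) ≡ Φ z
    Φ-choose z =
      maxHead-All (∈-factorizationsOf z) (all-filter (λ y → Φ y ≟ Φ z) (vecsBoundedBy (Φ z) (suc k)))

    head≤head-choose : ∀ z → head z ≤ head (choose (Φ z))
    head≤head-choose z = head≤maxHead (∈-factorizationsOf z)

    -- If D − m ∈ S for D = Σ ĉᵢnᵢ, adding m to a factorization of D − m beats c₀.
    maxHead⇒apery : ∀ c → (∀ y → Φ y ≡ Φ c → head y ≤ head c) → InApery S m (dot (tail c) ns)
    maxHead⇒apery (c₀ ∷ ĉ) maximal = apery-intro (dot-∈S (VAll.map proj₁ ns∈Ap) ĉ) λ m≤D D∸m∈S →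
      let y , Φy≡D∸m = factorization _ D∸m∈S in beaten y Φy≡D∸m m≤D
      where
      open +-*-Solver
      shift : ∀ c y n Y → (suc c + y) * n + Y ≡ c * n + (n + (y * n + Y))
      shift = solve 4 (λ c y n Y → ((con 1 :+ c) :+ y) :* n :+ Y := c :* n :+ (n :+ (y :* n :+ Y))) refl

      beaten : ∀ y → Φ y ≡ dot ĉ ns ∸ m → m ≤ dot ĉ ns → ⊥
      beaten (y₀ ∷ ŷ) Φy≡D∸m m≤D = <⇒≱ (s≤s (m≤m+n c₀ y₀)) (maximal ((suc c₀ + y₀) ∷ ŷ) (begin
        (suc c₀ + y₀) * m + dot ŷ ns       ≡⟨ shift c₀ y₀ m (dot ŷ ns) ⟩
        c₀ * m + (m + Φ (y₀ ∷ ŷ))          ≡⟨ cong (λ t → c₀ * m + (m + t)) Φy≡D∸m ⟩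
        c₀ * m + (m + (dot ĉ ns ∸ m))      ≡⟨ cong (c₀ * m +_) (m+[n∸m]≡n m≤D) ⟩
        c₀ * m + dot ĉ ns                  ∎))

    open CanonicalPresentation m ns g>0 choose Φ-choose using (ρ; ρ-isPresentation; ρ-minimal) public

    ρ-mCentric : IsMCentric S m ns ρ
    ρ-mCentric _ v (refl , _ , _) =
      apery⇒inZP ns∈Ap (tail (choose (Φ v))) (maxHead⇒apery (choose (Φ v)) maximal)
      where
      maximal : ∀ y → Φ y ≡ Φ (choose (Φ v)) → head y ≤ head (choose (Φ v))
      maximal y Φy≡ =
        subst (λ b → head y ≤ head (choose b)) (trans Φy≡ (Φ-choose v)) (head≤head-choose y)

lemma5p10 : (S : ℕ → Bool) → IsNumericalSemigroup S →
            (m : ℕ) → .{{_ : NonZero m}} → IsMultiplicity S m →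
            (k : ℕ) (ns : Vec ℕ k) → MinimalGenerators S m ns →
            (Σ (Relation k) (λ ρ → IsMinimalPresentation m ns ρ × IsMCentric S m ns ρ))
            ×
            ((ρ : Relation k) → IsMinimalPresentation m ns ρ → IsMCentric S m ns ρ →
               ∀ z z' → ρ z z' →
                 InApery S m (φ m ns z ∸ head z * m)
                 × ((0 < head z) ⇔ (¬ InApery S m (φ m ns z))))
lemma5p10 S isNS m mult k ns mg =
  (ρ , (ρ-isPresentation , ρ-minimal) , ρ-mCentric) ,
  λ _ _ centric → mCentric⇒apery ns∈Ap centric
  where
  open NumericalSemigroup S isNS m mult
  open Generators mg
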